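{- Let $p$ be an odd prime and let $\alpha,\beta$ be $p$-integral rational numbers. If $\{\alpha\}_p\geq 1$, $\{\beta\}_p\geq 1$ and $\{\alpha\}_p+\{\beta\}_p\leq p$, then $$ {}_3F_2\bigg[\begin{matrix}\alpha&\beta&1-\alpha-\beta\\&1&1\end{matrix}\bigg|1\bigg]_p=\sum_{k=0}^{p-1}\frac{(\alpha)_k(\beta)_k(1-\alpha-\beta)_k}{(k!)^3}\equiv0\pmod{p^2}. $$
   Context: A rational number is $p$-integral if its denominator (in lowest terms) is not divisible by $p$; congruences modulo $p^2$ are taken in the ring of $p$-integral rationals. For a $p$-integral $\alpha$, $\{\alpha\}_p$ denotes the least non-negative residue of $\alpha$ modulo $p$, i.e. the unique integer $r\in\{0,1,\dots,p-1\}$ with $\alpha\equiv r\pmod p$. The Pochhammer symbol is $(\alpha)_0=1$ and $(\alpha)_k=\alpha(\alpha+1)\cdots(\alpha+k-1)$ for $k\geq1$. The truncated hypergeometric function is ${}_pF_q\big[\begin{smallmatrix}\alpha_1&\ldots&\alpha_p\\\beta_1&\ldots&\beta_q\end{smallmatrix}\big|x\big]_n=\sum_{k=0}^{n-1}\frac{(\alpha_1)_k\cdots(\alpha_p)_k}{(\beta_1)_k\cdots(\beta_q)_k}\cdot\frac{x^k}{k!}$. -}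

module Defs where

open import Data.Nat as ℕ using (ℕ; zero; suc; _!; _<_)
open import Data.Nat.Properties using (_!≢0)
open import Data.Nat.Divisibility using (_∣_)
open import Data.Integer as ℤ using (ℤ; +_)
open import Data.Rational as ℚ using (ℚ; _+_; _*_; _-_; 0ℚ; 1ℚ)
open import Relation.Binary.PropositionalEquality using (_≡_)
open import Relation.Nullary using (¬_)
open import Data.Product using (Σ; _×_)

ℕ→ℚ : ℕ → ℚ
ℕ→ℚ n = (+ n) ℚ./ 1

pIntegral : ℕ → ℚ → Set
pIntegral p x = ¬ (p ∣ ℚ.↧ₙ x)

-- x ≡ y (mod m) in the ring of p-integral rationals:
-- x - y = m * z for some p-integral z
CongMod : ℕ → ℕ → ℚ → ℚ → Set
CongMod p m x y = Σ ℚ (λ z → pIntegral p z × (x - y ≡ ℕ→ℚ m * z))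

IsLeastResidue : ℕ → ℚ → ℕ → Set
IsLeastResidue p x r = r < p × CongMod p p x (ℕ→ℚ r)

poch : ℚ → ℕ → ℚ
poch a zero    = 1ℚ
poch a (suc k) = poch a k * (a + ℕ→ℚ k)

invFact : ℕ → ℚ
invFact k = ((+ 1) ℚ./ (k !)) {{k !≢0}}

sumTo : ℕ → (ℕ → ℚ) → ℚ
sumTo zero    f = 0ℚ
sumTo (suc n) f = sumTo n f + f n

powℚ : ℚ → ℕ → ℚ
powℚ x zero = 1ℚ
powℚ x (suc k) = powℚ x k * x

-- truncated 3F2[a b c; 1 1 | x]_n with lower parameters 1,1
-- = Σ_{k<n} (a)_k (b)_k (c)_k / ((1)_k (1)_k) * x^k / k!
F32-11 : ℚ → ℚ → ℚ → ℚ → ℕ → ℚ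
F32-11 a b c x n =
  sumTo n (λ k → poch a k * poch b k * poch c k
                  * invFact k * invFact k * powℚ x k * invFact k)

module Submission where

-- Write F(x, y) = Σ_{k<p} T(x, y, k) with T(x, y, k) = (x)_k (y)_k (1-x-y)_k / k!³.
-- (1) Terminating Pfaff–Saalschütz: for n < M, Σ_{k<M} T(-n, b, k) = ((1-b)_n / n!)².
--     It follows by induction on n from the recurrence (n+1)² S(n+1) = (1+n-b)² S(n),
--     obtained by telescoping a WZ-type certificate.  This part is pure algebra over ℚ.
-- (2) F is regular at p: on p-integral arguments x ≡ x', y ≡ y' (mod p) it satisfies
--     F(x', y') ≡ F(x', y) + F(x, y') - F(x, y)  (mod p²).  Regular functions contain the
--     constants and coordinates and are closed under +, -, ×, Pochhammer symbols and finite
--     sums; 1/k! is p-integral for k < p, so F is regular.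
-- (3) α ≡ -(p-r) and β ≡ -(p-s) (mod p), so by (2)
--     F(α, β) ≡ F(α, -(p-s)) + F(-(p-r), β) - F(-(p-r), -(p-s))  (mod p²).  By (1) each of
--     the three terms is a square ((1-b)_n / n!)², and r + s ≤ p puts a factor divisible by
--     p into (1-b)_n.

module Supercongruence where
  open import Defs
  open import Data.Nat as ℕ using (ℕ; zero; suc; _!; _<_; _≤_; _∸_; NonZero; z≤n; s≤s)
  import Data.Nat.Properties as ℕP
  open import Data.Nat.Divisibility using (_∣_; divides; ∣-trans; ∣⇒≤; ∣1⇒≡1)
  open import Data.Nat.Primality using (Prime; euclidsLemma; prime⇒nonTrivial)
  open import Data.Integer as ℤ using (+_)
  import Data.Integer.Properties as ℤP
  open import Data.Integer.GCD using () renaming (gcd to gcdℤ)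
  open import Data.Rational as ℚ using (ℚ; _+_; _*_; _-_; -_; 0ℚ; 1ℚ; ↧_; ↧ₙ_)
  import Data.Rational.Properties as ℚP
  import Data.Rational.Unnormalised as ℚᵘ
  import Data.Rational.Unnormalised.Properties as ℚᵘP
  open import Data.Rational.Solver using (module +-*-Solver)
  open +-*-Solver
  open import Algebra.Properties.Group ℚP.+-0-group using (x∙y⁻¹≈ε⇒x≈y)
  open import Data.Product using (_,_)
  open import Data.Sum using (inj₁; inj₂; [_,_]′)
  open import Relation.Binary.PropositionalEquality
  open import Relation.Nullary using (¬_)

  -- The embedding ℕ → ℚ is a semiring homomorphism; we compute in unnormalised rationals,
  -- where i / n is literally the pair (i, n).

  toℚᵘ-/ : ∀ i n .{{_ : NonZero n}} → ℚ.toℚᵘ (i ℚ./ n) ℚᵘ.≃ (i ℚᵘ./ n)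
  toℚᵘ-/ i (suc d) = ℚP.toℚᵘ-fromℚᵘ (ℚᵘ.mkℚᵘ i d)

  ℕ→ℚ-+ : ∀ m n → ℕ→ℚ (m ℕ.+ n) ≡ ℕ→ℚ m + ℕ→ℚ n
  ℕ→ℚ-+ m n = ℚP.toℚᵘ-injective (begin
    ℚ.toℚᵘ (ℕ→ℚ (m ℕ.+ n))                       ≈⟨ toℚᵘ-/ (+ (m ℕ.+ n)) 1 ⟩
    (+ (m ℕ.+ n)) ℚᵘ./ 1                          ≈⟨ ℚᵘ.*≡* integers ⟩
    ((+ m) ℚᵘ./ 1) ℚᵘ.+ ((+ n) ℚᵘ./ 1)            ≈⟨ ℚᵘP.+-cong (toℚᵘ-/ (+ m) 1) (toℚᵘ-/ (+ n) 1) ⟨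
    ℚ.toℚᵘ (ℕ→ℚ m) ℚᵘ.+ ℚ.toℚᵘ (ℕ→ℚ n)           ≈⟨ ℚP.toℚᵘ-homo-+ (ℕ→ℚ m) (ℕ→ℚ n) ⟨
    ℚ.toℚᵘ (ℕ→ℚ m + ℕ→ℚ n)                        ∎)
    where
    open ℚᵘP.≃-Reasoning
    integers : + (m ℕ.+ n) ℤ.* + 1 ≡ (+ m ℤ.* + 1 ℤ.+ + n ℤ.* + 1) ℤ.* + 1
    integers = cong (ℤ._* + 1) (trans (ℤP.pos-+ m n)
                 (sym (cong₂ ℤ._+_ (ℤP.*-identityʳ (+ m)) (ℤP.*-identityʳ (+ n)))))

  ℕ→ℚ-* : ∀ m n → ℕ→ℚ (m ℕ.* n) ≡ ℕ→ℚ m * ℕ→ℚ n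
  ℕ→ℚ-* m n = ℚP.toℚᵘ-injective (begin
    ℚ.toℚᵘ (ℕ→ℚ (m ℕ.* n))                       ≈⟨ toℚᵘ-/ (+ (m ℕ.* n)) 1 ⟩
    (+ (m ℕ.* n)) ℚᵘ./ 1                          ≈⟨ ℚᵘ.*≡* (cong (ℤ._* + 1) (ℤP.pos-* m n)) ⟩
    ((+ m) ℚᵘ./ 1) ℚᵘ.* ((+ n) ℚᵘ./ 1)            ≈⟨ ℚᵘP.*-cong (toℚᵘ-/ (+ m) 1) (toℚᵘ-/ (+ n) 1) ⟨
    ℚ.toℚᵘ (ℕ→ℚ m) ℚᵘ.* ℚ.toℚᵘ (ℕ→ℚ n)           ≈⟨ ℚP.toℚᵘ-homo-* (ℕ→ℚ m) (ℕ→ℚ n) ⟨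
    ℚ.toℚᵘ (ℕ→ℚ m * ℕ→ℚ n)                        ∎)
    where open ℚᵘP.≃-Reasoning

  ℕ→ℚ-suc : ∀ n → ℕ→ℚ (suc n) ≡ 1ℚ + ℕ→ℚ n
  ℕ→ℚ-suc = ℕ→ℚ-+ 1

  /-inverse : ∀ n .{{_ : NonZero n}} → ((+ 1) ℚ./ n) * ℕ→ℚ n ≡ 1ℚ
  /-inverse n@(suc _) = ℚP.toℚᵘ-injective (begin
    ℚ.toℚᵘ (((+ 1) ℚ./ n) * ℕ→ℚ n)                 ≈⟨ ℚP.toℚᵘ-homo-* ((+ 1) ℚ./ n) (ℕ→ℚ n) ⟩
    ℚ.toℚᵘ ((+ 1) ℚ./ n) ℚᵘ.* ℚ.toℚᵘ (ℕ→ℚ n)       ≈⟨ ℚᵘP.*-cong (toℚᵘ-/ (+ 1) n) (toℚᵘ-/ (+ n) 1) ⟩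
    ((+ 1) ℚᵘ./ n) ℚᵘ.* ((+ n) ℚᵘ./ 1)             ≈⟨ ℚᵘ.*≡* (ℤP.*-assoc (+ 1) (+ n) (+ 1)) ⟩
    (+ 1) ℚᵘ./ 1                                   ≈⟨ toℚᵘ-/ (+ 1) 1 ⟨
    ℚ.toℚᵘ 1ℚ                                      ∎)
    where open ℚᵘP.≃-Reasoning

  invFact-inverse : ∀ k → invFact k * ℕ→ℚ (k !) ≡ 1ℚ
  invFact-inverse k = /-inverse (k !) {{k ℕP.!≢0}}

  invFact-suc : ∀ j → invFact j ≡ invFact (suc j) * ℕ→ℚ (suc j)
  invFact-suc j = begin
    i                 ≡⟨ ℚP.*-identityʳ i ⟨
    i * 1ℚ            ≡⟨ cong (i *_) cancel ⟨
    i * (i' * F)      ≡⟨ solve 3 (λ i i' F → i :* (i' :* F) := i' :* (i :* F)) refl i i' F ⟩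
    i' * (i * F)      ≡⟨ cong (i' *_) (invFact-inverse j) ⟩
    i' * 1ℚ           ≡⟨ ℚP.*-identityʳ i' ⟩
    i'                ∎
    where
    open ≡-Reasoning
    i = invFact j
    i' = invFact (suc j) * ℕ→ℚ (suc j)
    F = ℕ→ℚ (j !)
    cancel : i' * F ≡ 1ℚ
    cancel = begin
      invFact (suc j) * ℕ→ℚ (suc j) * F    ≡⟨ ℚP.*-assoc (invFact (suc j)) _ _ ⟩
      invFact (suc j) * (ℕ→ℚ (suc j) * F)  ≡⟨ cong (invFact (suc j) *_) (ℕ→ℚ-* (suc j) (j !)) ⟨
      invFact (suc j) * ℕ→ℚ (suc j !)      ≡⟨ invFact-inverse (suc j) ⟩
      1ℚ                                   ∎

  sumTo-cong : ∀ N {f g : ℕ → ℚ} → (∀ k → f k ≡ g k) → sumTo N f ≡ sumTo N g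
  sumTo-cong zero    f≗g = refl
  sumTo-cong (suc N) f≗g = cong₂ _+_ (sumTo-cong N f≗g) (f≗g N)

  sumTo-linear : ∀ N a c (f g : ℕ → ℚ) →
                 sumTo N (λ k → a * f k - c * g k) ≡ a * sumTo N f - c * sumTo N g
  sumTo-linear zero a c f g = solve 2 (λ a c → con 0ℚ := a :* con 0ℚ :- c :* con 0ℚ) refl a c
  sumTo-linear (suc N) a c f g = trans (cong (_+ (a * f N - c * g N)) (sumTo-linear N a c f g))
    (solve 6 (λ a c F G x y → a :* F :- c :* G :+ (a :* x :- c :* y) := a :* (F :+ x) :- c :* (G :+ y))
           refl a c (sumTo N f) (sumTo N g) (f N) (g N))

  telescope : ∀ N (D G : ℕ → ℚ) → (∀ k → D k ≡ G (suc k) - G k) → sumTo N D ≡ G N - G 0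
  telescope zero    D G step = sym (ℚP.+-inverseʳ (G 0))
  telescope (suc N) D G step = trans (cong₂ _+_ (telescope N D G step) (step N))
    (solve 3 (λ a b c → (b :- a) :+ (c :- b) := c :- a) refl (G 0) (G N) (G (suc N)))

  sumTo-first : ∀ M (f : ℕ → ℚ) → (∀ k → f (suc k) ≡ 0ℚ) → sumTo (suc M) f ≡ f 0
  sumTo-first zero    f vanish = ℚP.+-identityˡ (f 0)
  sumTo-first (suc M) f vanish =
    trans (cong₂ _+_ (sumTo-first M f vanish) (vanish M)) (ℚP.+-identityʳ (f 0))

  poch-suc : ∀ a k → poch a (suc k) ≡ a * poch (a + 1ℚ) k
  poch-suc a zero    = solve 1 (λ a → con 1ℚ :* (a :+ con 0ℚ) := a :* con 1ℚ) refl a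
  poch-suc a (suc k) = begin
    poch a (suc k) * (a + ℕ→ℚ (suc k))       ≡⟨ cong₂ _*_ (poch-suc a k) (cong (λ m → a + m) (ℕ→ℚ-suc k)) ⟩
    a * poch (a + 1ℚ) k * (a + (1ℚ + ℕ→ℚ k)) ≡⟨ solve 3 (λ a P K → a :* P :* (a :+ (con 1ℚ :+ K))
                                                        := a :* (P :* (a :+ con 1ℚ :+ K)))
                                                  refl a (poch (a + 1ℚ) k) (ℕ→ℚ k) ⟩
    a * (poch (a + 1ℚ) k * (a + 1ℚ + ℕ→ℚ k)) ∎
    where open ≡-Reasoning

  -- (-n)_k = 0 as soon as k > n: the factor -n + n occurs.
  poch-vanishes : ∀ n k → n < k → poch (- ℕ→ℚ n) k ≡ 0ℚ
  poch-vanishes n (suc k) (s≤s n≤k) with ℕP.m≤n⇒m<n∨m≡n n≤k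
  ... | inj₁ n<k  = trans (cong (_* (- ℕ→ℚ n + ℕ→ℚ k)) (poch-vanishes n k n<k))
                          (ℚP.*-zeroˡ (- ℕ→ℚ n + ℕ→ℚ k))
  ... | inj₂ refl = trans (cong (poch (- ℕ→ℚ n) n *_) (ℚP.+-inverseˡ (ℕ→ℚ n)))
                          (ℚP.*-zeroʳ (poch (- ℕ→ℚ n) n))

  term : ℚ → ℚ → ℕ → ℚ
  term x y k = poch x k * poch y k * poch (1ℚ - x - y) k * invFact k * invFact k * invFact k

  powℚ-one : ∀ k → powℚ 1ℚ k ≡ 1ℚ
  powℚ-one zero    = refl
  powℚ-one (suc k) = cong (_* 1ℚ) (powℚ-one k)

  F32-as-sum : ∀ x y N → F32-11 x y (1ℚ - x - y) 1ℚ N ≡ sumTo N (term x y)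
  F32-as-sum x y N = sumTo-cong N λ k →
    let A = poch x k * poch y k * poch (1ℚ - x - y) k * invFact k * invFact k in
    trans (cong (λ w → A * w * invFact k) (powℚ-one k)) (cong (_* invFact k) (ℚP.*-identityʳ A))

  term-symmetric : ∀ x y k → term x y k ≡ term y x k
  term-symmetric x y k = begin
    poch x k * poch y k * poch (1ℚ - x - y) k * i * i * i
      ≡⟨ cong (λ z → poch x k * poch y k * poch z k * i * i * i)
              (solve 2 (λ x y → con 1ℚ :- x :- y := con 1ℚ :- y :- x) refl x y) ⟩
    poch x k * poch y k * poch (1ℚ - y - x) k * i * i * i
      ≡⟨ cong (λ z → z * poch (1ℚ - y - x) k * i * i * i) (ℚP.*-comm (poch x k) (poch y k)) ⟩
    poch y k * poch x k * poch (1ℚ - y - x) k * i * i * i ∎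
    where
    open ≡-Reasoning
    i = invFact k

  -- Terminating Pfaff–Saalschütz summation: for n < M,
  --   Σ_{k<M} (-n)_k (b)_k (1+n-b)_k / k!³ = ((1-b)_n / n!)².
  module TerminatingSaalschütz (b : ℚ) where

    third : ℕ → ℚ
    third n = 1ℚ - (- ℕ→ℚ n) - b

    S : ℕ → ℕ → ℚ
    S M n = sumTo M (term (- ℕ→ℚ n) b)

    -- WZ-type certificate: its differences in k are the summands of (n+1)² S(n+1) - (1+n-b)² S(n).
    certificate : ℕ → ℕ → ℚ
    certificate n zero    = 0ℚ
    certificate n (suc j) = (ℕ→ℚ n + ℕ→ℚ n + 1ℚ + 1ℚ - b) * poch (- ℕ→ℚ n) j * poch b (suc j)
                            * poch (third (suc n)) j * invFact j * invFact j * invFact j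

    -- The rational identity behind the certificate at k = j+1, with the Pochhammer symbols and
    -- factorials abstracted (and their defining relations as hypotheses): N = n, J = j, s = n+1,
    -- A = (-n)_j, B = (b)_{j+1}, C = (2+n-b)_j, P = (-s)_{j+1}, Q = (1+n-b)_{j+1},
    -- i = 1/(j+1)!, i₀ = 1/j!, J₁ = j+1.
    certificate-algebra : ∀ N J A B C i s P Q i₀ J₁ →
      s ≡ 1ℚ + N → P ≡ (- s) * A → Q ≡ (1ℚ - (- N) - b) * C → i₀ ≡ i * (1ℚ + J) → J₁ ≡ 1ℚ + J →
      s * s * (P * B * (C * ((1ℚ - (- s) - b) + J)) * i * i * i)
        - (1ℚ - (- N) - b) * (1ℚ - (- N) - b) * (A * (- N + J) * B * Q * i * i * i)
      ≡ (N + N + 1ℚ + 1ℚ - b) * (A * (- N + J)) * (B * (b + J₁)) * (C * ((1ℚ - (- s) - b) + J)) * i * i * i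
        - (N + N + 1ℚ + 1ℚ - b) * A * B * C * i₀ * i₀ * i₀
    certificate-algebra N J A B C i _ _ _ _ _ refl refl refl refl refl = solve 7 (λ N b J A B C i →
        (con 1ℚ :+ N) :* (con 1ℚ :+ N)
          :* ((:- (con 1ℚ :+ N) :* A) :* B :* (C :* ((con 1ℚ :- (:- (con 1ℚ :+ N)) :- b) :+ J)) :* i :* i :* i)
        :- (con 1ℚ :- (:- N) :- b) :* (con 1ℚ :- (:- N) :- b)
          :* (A :* (:- N :+ J) :* B :* ((con 1ℚ :- (:- N) :- b) :* C) :* i :* i :* i)
        := (N :+ N :+ con 1ℚ :+ con 1ℚ :- b) :* (A :* (:- N :+ J)) :* (B :* (b :+ (con 1ℚ :+ J)))
             :* (C :* ((con 1ℚ :- (:- (con 1ℚ :+ N)) :- b) :+ J)) :* i :* i :* i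
           :- (N :+ N :+ con 1ℚ :+ con 1ℚ :- b) :* A :* B :* C
             :* (i :* (con 1ℚ :+ J)) :* (i :* (con 1ℚ :+ J)) :* (i :* (con 1ℚ :+ J))) refl N b J A B C i

    -- At k = 0 all Pochhammer symbols and factorials are 1 and the identity is
    -- (n+1)² - (1+n-b)² = (2n+2-b) b.
    certificate-difference : ∀ n k →
      ℕ→ℚ (suc n) * ℕ→ℚ (suc n) * term (- ℕ→ℚ (suc n)) b k - third n * third n * term (- ℕ→ℚ n) b k
      ≡ certificate n (suc k) - certificate n k
    certificate-difference n zero = at-zero (ℕ→ℚ (suc n)) (ℕ→ℚ-suc n)
      where
      at-zero : ∀ s → s ≡ 1ℚ + ℕ→ℚ n →
        s * s * (1ℚ * 1ℚ * 1ℚ * 1ℚ * 1ℚ * 1ℚ) - third n * third n * (1ℚ * 1ℚ * 1ℚ * 1ℚ * 1ℚ * 1ℚ)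
        ≡ (ℕ→ℚ n + ℕ→ℚ n + 1ℚ + 1ℚ - b) * 1ℚ * (1ℚ * (b + 0ℚ)) * 1ℚ * 1ℚ * 1ℚ * 1ℚ - 0ℚ
      at-zero _ refl = solve 2 (λ N b →
        (con 1ℚ :+ N) :* (con 1ℚ :+ N) :* (con 1ℚ :* con 1ℚ :* con 1ℚ :* con 1ℚ :* con 1ℚ :* con 1ℚ)
          :- (con 1ℚ :- (:- N) :- b) :* (con 1ℚ :- (:- N) :- b)
             :* (con 1ℚ :* con 1ℚ :* con 1ℚ :* con 1ℚ :* con 1ℚ :* con 1ℚ)
        := (N :+ N :+ con 1ℚ :+ con 1ℚ :- b) :* con 1ℚ :* (con 1ℚ :* (b :+ con 0ℚ))
             :* con 1ℚ :* con 1ℚ :* con 1ℚ :* con 1ℚ :- con 0ℚ) refl (ℕ→ℚ n) b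
    certificate-difference n (suc j) =
      certificate-algebra N (ℕ→ℚ j) (poch (- N) j) (poch b (suc j)) (poch (third (suc n)) j)
        (invFact (suc j)) s (poch (- s) (suc j)) (poch (third n) (suc j)) (invFact j) (ℕ→ℚ (suc j))
        (ℕ→ℚ-suc n) first-factor third-factor
        (trans (invFact-suc j) (cong (invFact (suc j) *_) (ℕ→ℚ-suc j))) (ℕ→ℚ-suc j)
      where
      N = ℕ→ℚ n
      s = ℕ→ℚ (suc n)
      first-factor : poch (- s) (suc j) ≡ (- s) * poch (- N) j
      first-factor = trans (poch-suc (- s) j) (cong (λ z → (- s) * poch z j)
        (trans (cong (λ z → - z + 1ℚ) (ℕ→ℚ-suc n))
               (solve 1 (λ N → :- (con 1ℚ :+ N) :+ con 1ℚ := :- N) refl N)))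
      third-factor : poch (third n) (suc j) ≡ third n * poch (third (suc n)) j
      third-factor = trans (poch-suc (third n) j) (cong (λ z → third n * poch z j)
        (trans (solve 2 (λ N b → con 1ℚ :- (:- N) :- b :+ con 1ℚ := con 1ℚ :- (:- (con 1ℚ :+ N)) :- b)
                        refl N b)
               (cong (λ z → 1ℚ - (- z) - b) (sym (ℕ→ℚ-suc n)))))

    certificate-vanishes : ∀ n j → n < j → certificate n (suc j) ≡ 0ℚ
    certificate-vanishes n j n<j =
      trans (cong (λ z → w * z * poch b (suc j) * poch (third (suc n)) j * i * i * i) (poch-vanishes n j n<j))
            (solve 4 (λ w B C i → w :* con 0ℚ :* B :* C :* i :* i :* i := con 0ℚ)
                   refl w (poch b (suc j)) (poch (third (suc n)) j) i)
      where
      w = ℕ→ℚ n + ℕ→ℚ n + 1ℚ + 1ℚ - b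
      i = invFact j

    recurrence : ∀ M n → suc (suc n) ≤ M →
                 ℕ→ℚ (suc n) * ℕ→ℚ (suc n) * S M (suc n) ≡ third n * third n * S M n
    recurrence (suc j) n (s≤s n<j) = x∙y⁻¹≈ε⇒x≈y _ _ (begin
      a * S (suc j) (suc n) - c * S (suc j) n
        ≡⟨ sumTo-linear (suc j) a c (term (- ℕ→ℚ (suc n)) b) (term (- ℕ→ℚ n) b) ⟨
      sumTo (suc j) (λ k → a * term (- ℕ→ℚ (suc n)) b k - c * term (- ℕ→ℚ n) b k)
        ≡⟨ telescope (suc j) _ (certificate n) (certificate-difference n) ⟩
      certificate n (suc j) - 0ℚ
        ≡⟨ cong (_- 0ℚ) (certificate-vanishes n j n<j) ⟩
      0ℚ ∎)
      where
      open ≡-Reasoning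
      a = ℕ→ℚ (suc n) * ℕ→ℚ (suc n)
      c = third n * third n

    evaluation : ∀ M n → suc n ≤ M → S M n * (ℕ→ℚ (n !) * ℕ→ℚ (n !)) ≡ poch (1ℚ - b) n * poch (1ℚ - b) n
    evaluation (suc M) zero _ = cong (_* (1ℚ * 1ℚ)) (sumTo-first M (term (- ℕ→ℚ 0) b) higher-terms-vanish)
      where
      higher-terms-vanish : ∀ k → term (- ℕ→ℚ 0) b (suc k) ≡ 0ℚ
      higher-terms-vanish k =
        trans (cong (λ z → z * B * C * i * i * i) (poch-vanishes 0 (suc k) (s≤s z≤n)))
              (solve 3 (λ B C i → con 0ℚ :* B :* C :* i :* i :* i := con 0ℚ) refl B C i)
        where
        B = poch b (suc k)
        C = poch (1ℚ - (- ℕ→ℚ 0) - b) (suc k)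
        i = invFact (suc k)
    evaluation M (suc n) n+2≤M = begin
      S' * (ℕ→ℚ (suc n ℕ.* n !) * ℕ→ℚ (suc n ℕ.* n !))
        ≡⟨ cong (λ z → S' * (z * z)) (ℕ→ℚ-* (suc n) (n !)) ⟩
      S' * ((s * F) * (s * F))
        ≡⟨ solve 3 (λ S' s F → S' :* ((s :* F) :* (s :* F)) := (s :* s :* S') :* (F :* F)) refl S' s F ⟩
      (s * s * S') * (F * F)
        ≡⟨ cong (_* (F * F)) (recurrence M n n+2≤M) ⟩
      (third n * third n * S M n) * (F * F)
        ≡⟨ solve 3 (λ c S F → (c :* c :* S) :* (F :* F) := c :* c :* (S :* (F :* F))) refl (third n) (S M n) F ⟩
      third n * third n * (S M n * (F * F))
        ≡⟨ cong (third n * third n *_) (evaluation M n (ℕP.<⇒≤ n+2≤M)) ⟩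
      third n * third n * (P * P)
        ≡⟨ solve 3 (λ N b P → (con 1ℚ :- (:- N) :- b) :* (con 1ℚ :- (:- N) :- b) :* (P :* P)
                               := (P :* (con 1ℚ :- b :+ N)) :* (P :* (con 1ℚ :- b :+ N))) refl (ℕ→ℚ n) b P ⟩
      (P * (1ℚ - b + ℕ→ℚ n)) * (P * (1ℚ - b + ℕ→ℚ n)) ∎
      where
      open ≡-Reasoning
      S' = S M (suc n)
      s = ℕ→ℚ (suc n)
      F = ℕ→ℚ (n !)
      P = poch (1ℚ - b) n

    saalschütz : ∀ M n → suc n ≤ M → S M n ≡ (poch (1ℚ - b) n * invFact n) * (poch (1ℚ - b) n * invFact n)
    saalschütz M n n<M = begin
      S M n                           ≡⟨ ℚP.*-identityʳ (S M n) ⟨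
      S M n * 1ℚ                      ≡⟨ cong (λ z → S M n * (z * z)) (invFact-inverse n) ⟨
      S M n * ((i * F) * (i * F))     ≡⟨ solve 3 (λ S i F → S :* ((i :* F) :* (i :* F)) := (S :* (F :* F)) :* (i :* i))
                                               refl (S M n) i F ⟩
      (S M n * (F * F)) * (i * i)     ≡⟨ cong (_* (i * i)) (evaluation M n n<M) ⟩
      P * P * (i * i)                 ≡⟨ solve 2 (λ P i → P :* P :* (i :* i) := (P :* i) :* (P :* i)) refl P i ⟩
      (P * i) * (P * i)               ∎
      where
      open ≡-Reasoning
      i = invFact n
      F = ℕ→ℚ (n !)
      P = poch (1ℚ - b) n

  denominator-/ : ∀ i n .{{_ : NonZero n}} → ↧ₙ (i ℚ./ n) ∣ n
  denominator-/ i n = divides ℤ.∣ gcdℤ i (+ n) ∣ (begin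
    n                                          ≡⟨ cong ℤ.∣_∣ (ℚP.↧-/ i n) ⟨
    ℤ.∣ ↧ (i ℚ./ n) ℤ.* gcdℤ i (+ n) ∣         ≡⟨ ℤP.abs-* (↧ (i ℚ./ n)) (gcdℤ i (+ n)) ⟩
    ↧ₙ (i ℚ./ n) ℕ.* ℤ.∣ gcdℤ i (+ n) ∣        ≡⟨ ℕP.*-comm (↧ₙ (i ℚ./ n)) _ ⟩
    ℤ.∣ gcdℤ i (+ n) ∣ ℕ.* ↧ₙ (i ℚ./ n)        ∎)
    where open ≡-Reasoning

  denominator-+ : ∀ x y → ↧ₙ (x + y) ∣ ↧ₙ x ℕ.* ↧ₙ y
  denominator-+ x@record{} y@record{} = denominator-/ (ℚ.↥ x ℤ.* ↧ y ℤ.+ ℚ.↥ y ℤ.* ↧ x) (↧ₙ x ℕ.* ↧ₙ y)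

  denominator-* : ∀ x y → ↧ₙ (x * y) ∣ ↧ₙ x ℕ.* ↧ₙ y
  denominator-* x@record{} y@record{} = denominator-/ (ℚ.↥ x ℤ.* ℚ.↥ y) (↧ₙ x ℕ.* ↧ₙ y)

  module AtPrime (p : ℕ) (prime : Prime p) where

    -- pIntegral wrapped in a record, so that the rational can be inferred from a proof.
    record Integral (x : ℚ) : Set where
      constructor integral
      field notDivisible : pIntegral p x

    integral-+ : ∀ {x y} → Integral x → Integral y → Integral (x + y)
    integral-+ {x} {y} (integral ix) (integral iy) = integral λ p∣ →
      [ ix , iy ]′ (euclidsLemma (↧ₙ x) (↧ₙ y) prime (∣-trans p∣ (denominator-+ x y)))

    integral-* : ∀ {x y} → Integral x → Integral y → Integral (x * y)
    integral-* {x} {y} (integral ix) (integral iy) = integral λ p∣ →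
      [ ix , iy ]′ (euclidsLemma (↧ₙ x) (↧ₙ y) prime (∣-trans p∣ (denominator-* x y)))

    integral-neg : ∀ {x} → Integral x → Integral (- x)
    integral-neg {x} (integral ix) = integral λ p∣ → ix (subst (p ∣_) (cong ℤ.∣_∣ (ℚP.↧-neg x)) p∣)

    integral-- : ∀ {x y} → Integral x → Integral y → Integral (x - y)
    integral-- ix iy = integral-+ ix (integral-neg iy)

    p∤1 : ¬ (p ∣ 1)
    p∤1 p∣1 = ℕ.nonTrivial⇒≢1 {{prime⇒nonTrivial prime}} (∣1⇒≡1 p∣1)

    integral-ℕ : ∀ n → Integral (ℕ→ℚ n)
    integral-ℕ n = integral λ p∣ → p∤1 (∣-trans p∣ (denominator-/ (+ n) 1))

    p∤k! : ∀ k → k < p → ¬ (p ∣ k !)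
    p∤k! zero    _   p∣ = p∤1 p∣
    p∤k! (suc k) k<p p∣ with euclidsLemma (suc k) (k !) prime p∣
    ... | inj₁ p∣k+1 = ℕP.<⇒≱ k<p (∣⇒≤ p∣k+1)
    ... | inj₂ p∣k!  = p∤k! k (ℕP.<-trans (ℕP.n<1+n k) k<p) p∣k!

    integral-invFact : ∀ k → k < p → Integral (invFact k)
    integral-invFact k k<p = integral λ p∣ → p∤k! k k<p (∣-trans p∣ (denominator-/ (+ 1) (k !) {{k ℕP.!≢0}}))

    integral-poch : ∀ {a} n → Integral a → Integral (poch a n)
    integral-poch zero    ia = integral-ℕ 1
    integral-poch (suc n) ia = integral-* (integral-poch n ia) (integral-+ ia (integral-ℕ n))

    pℚ : ℚ
    pℚ = ℕ→ℚ p

    record _∣ₚ_ (c x : ℚ) : Set where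
      constructor factor
      field
        quotient          : ℚ
        quotient-integral : Integral quotient
        factorisation     : x ≡ c * quotient

    ∣ₚ-zero : ∀ {c x} → x ≡ 0ℚ → c ∣ₚ x
    ∣ₚ-zero {c} x≡0 = factor 0ℚ (integral-ℕ 0) (trans x≡0 (sym (ℚP.*-zeroʳ c)))

    ∣ₚ-resp : ∀ {c x y} → x ≡ y → c ∣ₚ x → c ∣ₚ y
    ∣ₚ-resp x≡y = subst (_ ∣ₚ_) x≡y

    ∣ₚ-+ : ∀ {c x y} → c ∣ₚ x → c ∣ₚ y → c ∣ₚ (x + y)
    ∣ₚ-+ {c} (factor z iz refl) (factor w iw refl) = factor (z + w) (integral-+ iz iw)
      (solve 3 (λ c z w → c :* z :+ c :* w := c :* (z :+ w)) refl c z w)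

    ∣ₚ-neg : ∀ {c x} → c ∣ₚ x → c ∣ₚ (- x)
    ∣ₚ-neg {c} (factor z iz refl) = factor (- z) (integral-neg iz)
      (solve 2 (λ c z → :- (c :* z) := c :* (:- z)) refl c z)

    ∣ₚ-- : ∀ {c x y} → c ∣ₚ x → c ∣ₚ y → c ∣ₚ (x - y)
    ∣ₚ-- c∣x c∣y = ∣ₚ-+ c∣x (∣ₚ-neg c∣y)

    ∣ₚ-*ʳ : ∀ {c x y} → c ∣ₚ x → Integral y → c ∣ₚ (x * y)
    ∣ₚ-*ʳ {c} {y = y} (factor z iz refl) iy = factor (z * y) (integral-* iz iy)
      (solve 3 (λ c z y → (c :* z) :* y := c :* (z :* y)) refl c z y)

    ∣ₚ-*ˡ : ∀ {c x y} → Integral x → c ∣ₚ y → c ∣ₚ (x * y)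
    ∣ₚ-*ˡ {c} {x} ix (factor z iz refl) = factor (x * z) (integral-* ix iz)
      (solve 3 (λ c z x → x :* (c :* z) := c :* (x :* z)) refl c z x)

    ∣ₚ-product : ∀ {c d x y} → c ∣ₚ x → d ∣ₚ y → (c * d) ∣ₚ (x * y)
    ∣ₚ-product {c} {d} (factor z iz refl) (factor w iw refl) = factor (z * w) (integral-* iz iw)
      (solve 4 (λ c d z w → (c :* z) :* (d :* w) := (c :* d) :* (z :* w)) refl c d z w)

    residue-divisibility : ∀ α {r} → IsLeastResidue p α r → pℚ ∣ₚ (α - ℕ→ℚ r)
    residue-divisibility _ (_ , z , iz , α-r≡pz) = factor z (integral iz) α-r≡pz

    p²-congruence : ∀ {x} → (pℚ * pℚ) ∣ₚ x → CongMod p (p ℕ.* p) x 0ℚ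
    p²-congruence {x} (factor z (integral iz) x≡p²z) =
      z , iz , trans (ℚP.+-identityʳ x) (trans x≡p²z (cong (_* z) (sym (ℕ→ℚ-* p p))))

    integral-congruent : ∀ {x x'} → Integral x → pℚ ∣ₚ (x' - x) → Integral x'
    integral-congruent {x} {x'} ix (factor z iz x'-x≡pz) =
      subst Integral (solve 2 (λ x' x → (x' :- x) :+ x := x') refl x' x)
        (integral-+ (subst Integral (sym x'-x≡pz) (integral-* (integral-ℕ p) iz)) ix)

    -- f is regular at p if, on p-integral arguments, it is p-integral, changing one argument
    -- within its class mod p changes f by a multiple of p, and its mixed second difference by
    -- a multiple of p².  (Every polynomial with p-integral coefficients is regular.)
    record Regular (f : ℚ → ℚ → ℚ) : Set where
      field
        integral-value : ∀ {x y} → Integral x → Integral y → Integral (f x y)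
        congruent₁ : ∀ {x x' y} → Integral x → Integral y → pℚ ∣ₚ (x' - x) →
                     pℚ ∣ₚ (f x' y - f x y)
        congruent₂ : ∀ {x y y'} → Integral x → Integral y → pℚ ∣ₚ (y' - y) →
                     pℚ ∣ₚ (f x y' - f x y)
        mixed      : ∀ {x x' y y'} → Integral x → Integral y → pℚ ∣ₚ (x' - x) → pℚ ∣ₚ (y' - y) →
                     (pℚ * pℚ) ∣ₚ (f x' y' - f x' y - f x y' + f x y)
    open Regular

    regular-const : ∀ c → Integral c → Regular (λ _ _ → c)
    regular-const c ic = record
      { integral-value = λ _ _ → ic
      ; congruent₁ = λ _ _ _ → ∣ₚ-zero (ℚP.+-inverseʳ c)
      ; congruent₂ = λ _ _ _ → ∣ₚ-zero (ℚP.+-inverseʳ c)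
      ; mixed      = λ _ _ _ _ → ∣ₚ-zero (solve 1 (λ c → c :- c :- c :+ c := con 0ℚ) refl c) }

    regular-fst : Regular (λ x _ → x)
    regular-fst = record
      { integral-value = λ ix _ → ix
      ; congruent₁ = λ _ _ x≡x' → x≡x'
      ; congruent₂ = λ {x} _ _ _ → ∣ₚ-zero (ℚP.+-inverseʳ x)
      ; mixed      = λ {x} {x'} _ _ _ _ →
          ∣ₚ-zero (solve 2 (λ x' x → x' :- x' :- x :+ x := con 0ℚ) refl x' x) }

    regular-snd : Regular (λ _ y → y)
    regular-snd = record
      { integral-value = λ _ iy → iy
      ; congruent₁ = λ {_} {_} {y} _ _ _ → ∣ₚ-zero (ℚP.+-inverseʳ y)
      ; congruent₂ = λ _ _ y≡y' → y≡y'
      ; mixed      = λ {_} {_} {y} {y'} _ _ _ _ →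
          ∣ₚ-zero (solve 2 (λ y' y → y' :- y :- y' :+ y := con 0ℚ) refl y' y) }

    regular-+ : ∀ {f g} → Regular f → Regular g → Regular (λ x y → f x y + g x y)
    regular-+ {f} {g} F G = record
      { integral-value = λ ix iy → integral-+ (integral-value F ix iy) (integral-value G ix iy)
      ; congruent₁ = λ {x} {x'} {y} ix iy dx → ∣ₚ-resp (sym (split₂ (f x' y) (g x' y) (f x y) (g x y)))
                       (∣ₚ-+ (congruent₁ F ix iy dx) (congruent₁ G ix iy dx))
      ; congruent₂ = λ {x} {y} {y'} ix iy dy → ∣ₚ-resp (sym (split₂ (f x y') (g x y') (f x y) (g x y)))
                       (∣ₚ-+ (congruent₂ F ix iy dy) (congruent₂ G ix iy dy))
      ; mixed      = λ {x} {x'} {y} {y'} ix iy dx dy → ∣ₚ-resp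
                       (sym (split₄ (f x' y') (f x' y) (f x y') (f x y) (g x' y') (g x' y) (g x y') (g x y)))
                       (∣ₚ-+ (mixed F ix iy dx dy) (mixed G ix iy dx dy)) }
      where
      split₂ : ∀ a b c d → a + b - (c + d) ≡ (a - c) + (b - d)
      split₂ = solve 4 (λ a b c d → a :+ b :- (c :+ d) := (a :- c) :+ (b :- d)) refl
      split₄ : ∀ a b c d a' b' c' d' →
               (a + a') - (b + b') - (c + c') + (d + d') ≡ (a - b - c + d) + (a' - b' - c' + d')
      split₄ = solve 8 (λ a b c d a' b' c' d' → (a :+ a') :- (b :+ b') :- (c :+ c') :+ (d :+ d')
                                                := (a :- b :- c :+ d) :+ (a' :- b' :- c' :+ d')) refl

    regular-- : ∀ {f g} → Regular f → Regular g → Regular (λ x y → f x y - g x y)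
    regular-- {f} {g} F G = record
      { integral-value = λ ix iy → integral-- (integral-value F ix iy) (integral-value G ix iy)
      ; congruent₁ = λ {x} {x'} {y} ix iy dx → ∣ₚ-resp (sym (split₂ (f x' y) (g x' y) (f x y) (g x y)))
                       (∣ₚ-- (congruent₁ F ix iy dx) (congruent₁ G ix iy dx))
      ; congruent₂ = λ {x} {y} {y'} ix iy dy → ∣ₚ-resp (sym (split₂ (f x y') (g x y') (f x y) (g x y)))
                       (∣ₚ-- (congruent₂ F ix iy dy) (congruent₂ G ix iy dy))
      ; mixed      = λ {x} {x'} {y} {y'} ix iy dx dy → ∣ₚ-resp
                       (sym (split₄ (f x' y') (f x' y) (f x y') (f x y) (g x' y') (g x' y) (g x y') (g x y)))
                       (∣ₚ-- (mixed F ix iy dx dy) (mixed G ix iy dx dy)) }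
      where
      split₂ : ∀ a b c d → a - b - (c - d) ≡ (a - c) - (b - d)
      split₂ = solve 4 (λ a b c d → a :- b :- (c :- d) := (a :- c) :- (b :- d)) refl
      split₄ : ∀ a b c d a' b' c' d' →
               (a - a') - (b - b') - (c - c') + (d - d') ≡ (a - b - c + d) - (a' - b' - c' + d')
      split₄ = solve 8 (λ a b c d a' b' c' d' → (a :- a') :- (b :- b') :- (c :- c') :+ (d :- d')
                                                := (a :- b :- c :+ d) :- (a' :- b' :- c' :+ d')) refl

    -- Leibniz rules for the differences of a product; the cross terms of the mixed difference
    -- are products of two first differences, each divisible by p.
    regular-* : ∀ {f g} → Regular f → Regular g → Regular (λ x y → f x y * g x y)
    regular-* {f} {g} F G = record
      { integral-value = λ ix iy → integral-* (integral-value F ix iy) (integral-value G ix iy)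
      ; congruent₁ = λ {x} {x'} {y} ix iy dx → ∣ₚ-resp (sym (leibniz (f x' y) (g x' y) (f x y) (g x y)))
          (∣ₚ-+ (∣ₚ-*ʳ (congruent₁ F ix iy dx) (integral-value G (integral-congruent ix dx) iy))
                (∣ₚ-*ˡ (integral-value F ix iy) (congruent₁ G ix iy dx)))
      ; congruent₂ = λ {x} {y} {y'} ix iy dy → ∣ₚ-resp (sym (leibniz (f x y') (g x y') (f x y) (g x y)))
          (∣ₚ-+ (∣ₚ-*ʳ (congruent₂ F ix iy dy) (integral-value G ix (integral-congruent iy dy)))
                (∣ₚ-*ˡ (integral-value F ix iy) (congruent₂ G ix iy dy)))
      ; mixed      = λ {x} {x'} {y} {y'} ix iy dx dy → ∣ₚ-resp
          (sym (leibniz₂ (f x' y') (f x' y) (f x y') (f x y) (g x' y') (g x' y) (g x y') (g x y)))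
          (∣ₚ-+ (∣ₚ-+ (∣ₚ-+ (∣ₚ-*ʳ (mixed F ix iy dx dy)
                                   (integral-value G (integral-congruent ix dx) (integral-congruent iy dy)))
                            (∣ₚ-product (congruent₁ F ix iy dx) (congruent₂ G (integral-congruent ix dx) iy dy)))
                      (∣ₚ-product (congruent₂ F ix iy dy) (congruent₁ G ix (integral-congruent iy dy) dx)))
                (∣ₚ-*ˡ (integral-value F ix iy) (mixed G ix iy dx dy))) }
      where
      leibniz : ∀ a b c d → a * b - c * d ≡ (a - c) * b + c * (b - d)
      leibniz = solve 4 (λ a b c d → a :* b :- c :* d := (a :- c) :* b :+ c :* (b :- d)) refl
      leibniz₂ : ∀ f₁₁ f₁₀ f₀₁ f₀₀ g₁₁ g₁₀ g₀₁ g₀₀ →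
        f₁₁ * g₁₁ - f₁₀ * g₁₀ - f₀₁ * g₀₁ + f₀₀ * g₀₀ ≡
        (f₁₁ - f₁₀ - f₀₁ + f₀₀) * g₁₁ + (f₁₀ - f₀₀) * (g₁₁ - g₁₀) + (f₀₁ - f₀₀) * (g₁₁ - g₀₁)
          + f₀₀ * (g₁₁ - g₁₀ - g₀₁ + g₀₀)
      leibniz₂ = solve 8 (λ f₁₁ f₁₀ f₀₁ f₀₀ g₁₁ g₁₀ g₀₁ g₀₀ →
        f₁₁ :* g₁₁ :- f₁₀ :* g₁₀ :- f₀₁ :* g₀₁ :+ f₀₀ :* g₀₀ :=
        (f₁₁ :- f₁₀ :- f₀₁ :+ f₀₀) :* g₁₁ :+ (f₁₀ :- f₀₀) :* (g₁₁ :- g₁₀) :+ (f₀₁ :- f₀₀) :* (g₁₁ :- g₀₁)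
          :+ f₀₀ :* (g₁₁ :- g₁₀ :- g₀₁ :+ g₀₀)) refl

    regular-poch : ∀ {f} → Regular f → ∀ k → Regular (λ x y → poch (f x y) k)
    regular-poch F zero    = regular-const 1ℚ (integral-ℕ 1)
    regular-poch F (suc k) = regular-* (regular-poch F k) (regular-+ F (regular-const (ℕ→ℚ k) (integral-ℕ k)))

    regular-sumTo : ∀ N (f : ℕ → ℚ → ℚ → ℚ) → (∀ k → k < N → Regular (f k)) →
                    Regular (λ x y → sumTo N (λ k → f k x y))
    regular-sumTo zero    f F = regular-const 0ℚ (integral-ℕ 0)
    regular-sumTo (suc N) f F =
      regular-+ (regular-sumTo N f (λ k k<N → F k (ℕP.<-trans k<N (ℕP.n<1+n N)))) (F N (ℕP.n<1+n N))

    -- The truncated hypergeometric sum is regular: its summands are, since 1/k! is p-integral for k < p.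
    regular-sum : Regular (λ x y → sumTo p (term x y))
    regular-sum = regular-sumTo p (λ k x y → term x y k) λ k k<p →
      let 1/k! = regular-const (invFact k) (integral-invFact k k<p)
          1-x-y = regular-- (regular-- (regular-const 1ℚ (integral-ℕ 1)) regular-fst) regular-snd
      in regular-* (regular-* (regular-* (regular-* (regular-* (regular-poch regular-fst k)
           (regular-poch regular-snd k)) (regular-poch 1-x-y k)) 1/k!) 1/k!) 1/k!

    poch-divisible : ∀ {a} n j → Integral a → j < n → pℚ ∣ₚ (a + ℕ→ℚ j) → pℚ ∣ₚ poch a n
    poch-divisible (suc n) j ia (s≤s j≤n) p∣a+j with ℕP.m≤n⇒m<n∨m≡n j≤n
    ... | inj₁ j<n  = ∣ₚ-*ʳ (poch-divisible n j ia j<n p∣a+j) (integral-+ ia (integral-ℕ n))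
    ... | inj₂ refl = ∣ₚ-*ˡ (integral-poch j ia) p∣a+j

    -- If b ≡ j+1 (mod p) with j < n < p, then p² divides Σ_{k<p} T(-n, b, k): by the
    -- Saalschütz summation it is ((1-b)_n / n!)², and (1-b)_n has the factor 1-b+j ≡ 0.
    terminating-sum-divisible : ∀ {b} n j → Integral b → n < p → j < n → pℚ ∣ₚ (b - ℕ→ℚ (suc j)) →
                                (pℚ * pℚ) ∣ₚ sumTo p (term (- ℕ→ℚ n) b)
    terminating-sum-divisible {b} n j ib n<p j<n p∣b-j-1 =
      ∣ₚ-resp (sym (TerminatingSaalschütz.saalschütz b p n n<p)) (∣ₚ-product p∣P p∣P)
      where
      p∣1-b+j : pℚ ∣ₚ (1ℚ - b + ℕ→ℚ j)
      p∣1-b+j = ∣ₚ-resp (begin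
        - (b - ℕ→ℚ (suc j))     ≡⟨ cong (λ z → - (b - z)) (ℕ→ℚ-suc j) ⟩
        - (b - (1ℚ + ℕ→ℚ j))    ≡⟨ solve 2 (λ b J → :- (b :- (con 1ℚ :+ J)) := con 1ℚ :- b :+ J) refl b (ℕ→ℚ j) ⟩
        1ℚ - b + ℕ→ℚ j          ∎) (∣ₚ-neg p∣b-j-1)
        where open ≡-Reasoning
      p∣P : pℚ ∣ₚ (poch (1ℚ - b) n * invFact n)
      p∣P = ∣ₚ-*ʳ (poch-divisible n j (integral-- (integral-ℕ 1) ib) j<n p∣1-b+j) (integral-invFact n n<p)

    p∣p : pℚ ∣ₚ pℚ
    p∣p = factor 1ℚ (integral-ℕ 1) (sym (ℚP.*-identityʳ pℚ))

    complement : ∀ r → r ≤ p → ℕ→ℚ (p ∸ r) + ℕ→ℚ r ≡ pℚ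
    complement r r≤p = trans (sym (ℕ→ℚ-+ (p ∸ r) r)) (cong ℕ→ℚ (ℕP.m∸n+n≡m r≤p))

    negative-representative : ∀ α {r} → r ≤ p → pℚ ∣ₚ (α - ℕ→ℚ r) → pℚ ∣ₚ (α - (- ℕ→ℚ (p ∸ r)))
    negative-representative α {r} r≤p p∣α-r = ∣ₚ-resp (begin
      (α - R) + pℚ         ≡⟨ cong (λ w → (α - R) + w) (complement r r≤p) ⟨
      (α - R) + (N + R)    ≡⟨ solve 3 (λ a R N → (a :- R) :+ (N :+ R) := a :- (:- N)) refl α R N ⟩
      α - (- N)            ∎) (∣ₚ-+ p∣α-r p∣p)
      where
      open ≡-Reasoning
      R = ℕ→ℚ r
      N = ℕ→ℚ (p ∸ r)

    negative-residue : ∀ s → s ≤ p → pℚ ∣ₚ (- ℕ→ℚ (p ∸ s) - ℕ→ℚ s)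
    negative-residue s s≤p = ∣ₚ-resp (begin
      - pℚ                       ≡⟨ cong -_ (complement s s≤p) ⟨
      - (ℕ→ℚ (p ∸ s) + ℕ→ℚ s)    ≡⟨ solve 2 (λ N S → :- (N :+ S) := :- N :- S) refl (ℕ→ℚ (p ∸ s)) (ℕ→ℚ s) ⟩
      - ℕ→ℚ (p ∸ s) - ℕ→ℚ s      ∎) (∣ₚ-neg p∣p)
      where open ≡-Reasoning

    sum-divisible : ∀ {α β} r' s' → Integral α → Integral β →
                    pℚ ∣ₚ (α - ℕ→ℚ (suc r')) → pℚ ∣ₚ (β - ℕ→ℚ (suc s')) → suc r' ℕ.+ suc s' ≤ p →
                    (pℚ * pℚ) ∣ₚ sumTo p (term α β)
    sum-divisible {α} {β} r' s' iα iβ α≡r β≡s r+s≤p =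
      ∣ₚ-resp (sym regroup) (∣ₚ-- (∣ₚ-+ (∣ₚ-+ second-difference F[α,β₀]) F[α₀,β]) F[α₀,β₀])
      where
      F : ℚ → ℚ → ℚ
      F x y = sumTo p (term x y)
      r≤p : suc r' ≤ p
      r≤p = ℕP.m+n≤o⇒m≤o (suc r') r+s≤p
      s≤p : suc s' ≤ p
      s≤p = ℕP.m+n≤o⇒n≤o (suc r') r+s≤p
      n = p ∸ suc r'
      m = p ∸ suc s'
      n<p : n < p
      n<p = ℕP.∸-monoʳ-< {p} {suc r'} {0} (s≤s z≤n) r≤p
      m<p : m < p
      m<p = ℕP.∸-monoʳ-< {p} {suc s'} {0} (s≤s z≤n) s≤p
      -- r + s ≤ p is exactly what places the vanishing factor inside the range of (1-b)_n
      r'<m : r' < m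
      r'<m = ℕP.m+n≤o⇒m≤o∸n (suc r') r+s≤p
      s'<n : s' < n
      s'<n = ℕP.m+n≤o⇒m≤o∸n (suc s') (subst (_≤ p) (ℕP.+-comm (suc r') (suc s')) r+s≤p)
      α₀ = - ℕ→ℚ n
      β₀ = - ℕ→ℚ m
      iβ₀ : Integral β₀
      iβ₀ = integral-neg (integral-ℕ m)
      second-difference : (pℚ * pℚ) ∣ₚ (F α β - F α β₀ - F α₀ β + F α₀ β₀)
      second-difference = mixed regular-sum (integral-neg (integral-ℕ n)) iβ₀
                                (negative-representative α r≤p α≡r) (negative-representative β s≤p β≡s)
      F[α,β₀] : (pℚ * pℚ) ∣ₚ F α β₀
      F[α,β₀] = ∣ₚ-resp (sumTo-cong p (λ k → term-symmetric β₀ α k))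
                        (terminating-sum-divisible m r' iα m<p r'<m α≡r)
      F[α₀,β] : (pℚ * pℚ) ∣ₚ F α₀ β
      F[α₀,β] = terminating-sum-divisible n s' iβ n<p s'<n β≡s
      F[α₀,β₀] : (pℚ * pℚ) ∣ₚ F α₀ β₀
      F[α₀,β₀] = terminating-sum-divisible n s' iβ₀ n<p s'<n (negative-residue (suc s') s≤p)
      regroup : F α β ≡ (F α β - F α β₀ - F α₀ β + F α₀ β₀) + F α β₀ + F α₀ β - F α₀ β₀
      regroup = solve 4 (λ a b c d → a := (a :- b :- c :+ d) :+ b :+ c :- d) refl
                        (F α β) (F α β₀) (F α₀ β) (F α₀ β₀)


open import Defs
open import Data.Nat using (ℕ; suc; _≤_; _+_; _*_; s≤s; z≤n)
open import Data.Nat.Primality using (Prime)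
open import Data.Rational using (ℚ; 0ℚ; 1ℚ; _-_)
open import Relation.Binary.PropositionalEquality using (sym)
open Supercongruence using (module AtPrime; F32-as-sum)

theorem1 : (p : ℕ) → Prime p → 3 ≤ p →
    (α β : ℚ) → pIntegral p α → pIntegral p β →
    (r s : ℕ) → IsLeastResidue p α r → IsLeastResidue p β s →
    1 ≤ r → 1 ≤ s → r + s ≤ p →
    CongMod p (p * p)
    (F32-11 α β (1ℚ - α - β) 1ℚ p) 0ℚ
theorem1 p p-prime _ α β iα iβ (suc r') (suc s') α≡r β≡s (s≤s z≤n) (s≤s z≤n) r+s≤p =
  p²-congruence (∣ₚ-resp (sym (F32-as-sum α β p))
    (sum-divisible r' s' (integral iα) (integral iβ)
                   (residue-divisibility α α≡r) (residue-divisibility β β≡s) r+s≤p))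
  where open AtPrime p p-prime
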